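{- Let $T$ be a caterpillar with spine $S$, and let $m\ge 2$ be an integer. If $\Delta(T)\ge 4$ (i.e., $\deg(v)\ge 4$ for some vertex $v$ of $S$), then $\chi'_g(T;m,1)=\Delta(T)$.
   Context: A caterpillar is a finite tree $T$ in which there is a path $S$, called the spine, such that a vertex lies on $S$ if and only if its degree in $T$ is at least two; the spine is an induced subgraph of $T$. $\Delta(T)$ denotes the maximum degree of $T$. The $(m,1)$-edge coloring game on a finite simple graph $G$ with a set of colors $X$ is played alternately by two players, Maker and Breaker, with Maker playing first. On each turn Maker makes $m$ moves and Breaker makes one move; a move consists of coloring one uncolored edge of $G$ with a color from $X$ so that adjacent edges (edges sharing an endpoint) always receive distinct colors. Maker wins if eventually every edge is colored; Breaker wins if at some point the player who is to move cannot color any edge. The $(m,1)$-game chromatic index $\chi'_g(G;m,1)$ is the smallest nonnegative integer $k$ such that Maker has a winning strategy when $|X|=k$. -}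

module Defs where

open import Data.Nat using (ℕ; zero; suc; _≤_; _<_; _⊔_)
open import Data.Fin using (Fin; toℕ; _≟_)
open import Data.List using (List; length; filter; map; foldr)
open import Data.List.Base using (allFin)
open import Data.Maybe using (Maybe; just; nothing)
open import Data.Product using (Σ; ∃; ∃-syntax; _×_; _,_; proj₁; proj₂)
open import Data.Sum using (_⊎_)
open import Data.Bool using (if_then_else_)
open import Function.Bundles using (_⇔_)
open import Function.Definitions using (Injective)
open import Relation.Nullary using (¬_; Dec; does)
open import Relation.Nullary.Decidable using (_⊎-dec_)
open import Relation.Binary.PropositionalEquality using (_≡_; _≢_)
open import Relation.Binary.Construct.Closure.ReflexiveTransitive using (Star)

SameEnds : ∀ {V : ℕ} → Fin V × Fin V → Fin V × Fin V → Set
SameEnds (a , b) (c , d) = (a ≡ c × b ≡ d) ⊎ (a ≡ d × b ≡ c)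

record Graph : Set where
  field
    V        : ℕ
    E        : ℕ
    ends     : Fin E → Fin V × Fin V
    loopless : ∀ e → proj₁ (ends e) ≢ proj₂ (ends e)
    simple   : ∀ e f → SameEnds (ends e) (ends f) → e ≡ f

module _ (G : Graph) where
  open Graph G

  Incident : Fin V → Fin E → Set
  Incident v e = (v ≡ proj₁ (ends e)) ⊎ (v ≡ proj₂ (ends e))

  incident? : ∀ v e → Dec (Incident v e)
  incident? v e = (v ≟ proj₁ (ends e)) ⊎-dec (v ≟ proj₂ (ends e))

  Adj : Fin V → Fin V → Set
  Adj u v = ∃[ e ] SameEnds (ends e) (u , v)

  AdjEdges : Fin E → Fin E → Set
  AdjEdges e f = e ≢ f × ∃[ v ] (Incident v e × Incident v f)

  deg : Fin V → ℕ
  deg v = length (filter (incident? v) (allFin E))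

  Δ : ℕ
  Δ = foldr _⊔_ 0 (map deg (allFin V))

  Connected : Set
  Connected = ∀ u v → Star Adj u v

  IsTree : Set
  IsTree = Connected × (suc E ≡ V)

  record IsSpine (ℓ : ℕ) (s : Fin ℓ → Fin V) : Set where
    field
      distinct    : Injective _≡_ _≡_ s
      consecutive : ∀ i j → toℕ j ≡ suc (toℕ i) → Adj (s i) (s j)
      induced     : ∀ i j → Adj (s i) (s j) →
                    (toℕ j ≡ suc (toℕ i)) ⊎ (toℕ i ≡ suc (toℕ j))
      members     : ∀ v → (∃[ i ] s i ≡ v) ⇔ (2 ≤ deg v)

  IsCaterpillar : Set
  IsCaterpillar = IsTree × (∃[ ℓ ] Σ (Fin ℓ → Fin V) (IsSpine ℓ))

module Game (G : Graph) (m k : ℕ) where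
  open Graph G

  Coloring : Set
  Coloring = Fin E → Maybe (Fin k)

  Legal : Coloring → Fin E → Fin k → Set
  Legal c e a = c e ≡ nothing × (∀ f → AdjEdges G e f → c f ≢ just a)

  update : Coloring → Fin E → Fin k → Coloring
  update c e a f = if does (f ≟ e) then just a else c f

  Complete : Coloring → Set
  Complete c = ∀ e → c e ≢ nothing

  -- whose turn: Maker with r moves remaining in the current turn, or Breaker
  data Turn : Set where
    makerTurn   : ℕ → Turn
    breakerTurn : Turn

  next : Turn → Turn
  next (makerTurn (suc (suc r))) = makerTurn (suc r)
  next (makerTurn _)             = breakerTurn
  next breakerTurn               = makerTurn m

  -- Maker has a winning strategy from the given position
  -- (the game is finite, so an inductive predicate is exact).
  -- Maker wins once all edges are coloured; the player to move loses
  -- if no legal move is available.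
  data MakerWins : Turn → Coloring → Set where
    complete : ∀ {t c} → Complete c → MakerWins t c
    maker    : ∀ {r c} e a → Legal c e a →
               MakerWins (next (makerTurn r)) (update c e a) →
               MakerWins (makerTurn r) c
    breaker  : ∀ {c} → (∃[ e ] ∃[ a ] Legal c e a) →
               (∀ e a → Legal c e a → MakerWins (next breakerTurn) (update c e a)) →
               MakerWins breakerTurn c

  empty : Coloring
  empty _ = nothing

  MakerHasWinningStrategy : Set
  MakerHasWinningStrategy = MakerWins (makerTurn m) empty

GameChromaticIndexIs : Graph → ℕ → ℕ → Set
GameChromaticIndexIs G m k =
  Game.MakerHasWinningStrategy G m k × (∀ j → j < k → ¬ Game.MakerHasWinningStrategy G m j)

-- Lower bound: the moves of a play form a proper partial edge colouring, so a play that colours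
-- every edge gives the Δ edges at a vertex of maximum degree distinct colours.
-- Upper bound with k ≥ max Δ 4 colours: an uncoloured pendant edge can always be coloured, since
-- its coloured neighbours all meet it at one vertex of degree ≤ Δ ≤ k.  A spine edge meets at most
-- two other spine edges, so it stays colourable while at most one coloured pendant edge touches it.
-- Call a position calm if no uncoloured spine edge touches a coloured pendant edge.  Maker keeps
-- the position calm: he colours spine edges before pendant edges, and after Breaker colours a
-- pendant edge f he spends his first two moves on the at most two uncoloured spine edges touching f.

module Submission where

open import Defs
open import Data.Nat using (ℕ; zero; suc; _≤_; _<_; _+_; z≤n; s≤s; _≤?_)
open import Data.Nat.Properties
  using (≤-refl; ≤-trans; <-≤-trans; <-irrefl; suc-injective; ⊔-lub;
         m≤n⇒m≤n⊔o; m≤n⇒m≤o⊔n; +-mono-≤; +-mono-<-≤; +-mono-≤-<)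
open import Data.Nat.Induction using (<-wellFounded)
open import Data.Fin using (Fin; zero; suc; toℕ; _≟_)
open import Data.Fin.Patterns using (0F; 1F; 2F)
open import Data.Fin.Properties using (toℕ-injective; injective⇒≤; any?; all?; ¬∀⟶∃¬)
open import Data.List using (List; _∷_; lookup; filter; allFin; map)
open import Data.List.Properties using (foldr-preservesᵇ; foldr-preservesᵒ)
open import Data.List.Membership.Propositional.Properties
  using (∈-allFin; ∈-filter⁺; ∈-filter⁻; ∈-lookup)
import Data.List.Membership.Setoid.Properties as SetoidMembership
import Data.List.Relation.Unary.All as All
open import Data.List.Relation.Unary.Any as Any using (index)
import Data.List.Relation.Unary.Any.Properties as Any
import Data.List.Relation.Unary.All.Properties as All
open import Data.List.Relation.Unary.AllPairs using (_∷_)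
open import Data.List.Relation.Unary.Unique.Propositional using (Unique)
open import Data.List.Relation.Unary.Unique.Propositional.Properties using (filter⁺; allFin⁺)
open import Data.Maybe using (Maybe; just; nothing)
open import Data.Maybe.Properties using (just-injective; ≡-dec)
open import Data.Product using (∃-syntax; _×_; _,_; proj₁; proj₂)
open import Data.Sum using (_⊎_; inj₁; inj₂; [_,_])
open import Data.Empty using (⊥; ⊥-elim)
open import Function.Bundles using (Equivalence)
open import Function.Definitions using (Injective)
open import Induction.WellFounded using (Acc; acc)
open import Relation.Nullary using (¬_; Dec; yes; no; ¬?)
open import Relation.Nullary.Decidable using (_×-dec_; map′)
open import Relation.Binary.PropositionalEquality hiding ([_])

lookup-injective : ∀ {A : Set} (xs : List A) → Unique xs →
                   ∀ i j → lookup xs i ≡ lookup xs j → i ≡ j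
lookup-injective (x ∷ xs) u           zero    zero    eq = refl
lookup-injective (x ∷ xs) (x∉ ∷ u)    zero    (suc j) eq = ⊥-elim (All.lookup x∉ (∈-lookup j) eq)
lookup-injective (x ∷ xs) (x∉ ∷ u)    (suc i) zero    eq = ⊥-elim (All.lookup x∉ (∈-lookup i) (sym eq))
lookup-injective (x ∷ xs) (x∉ ∷ u)    (suc i) (suc j) eq = cong suc (lookup-injective xs u i j eq)

≡just⇒≢nothing : ∀ {A : Set} {x : Maybe A} {a} → x ≡ just a → x ≢ nothing
≡just⇒≢nothing refl ()

extract : ∀ {A : Set} (x : Maybe A) → x ≢ nothing → ∃[ a ] x ≡ just a
extract (just a) _ = a , refl
extract nothing  p = ⊥-elim (p refl)

isNothing : ∀ {A : Set} → Maybe A → ℕ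
isNothing nothing  = 1
isNothing (just _) = 0

isNothing-mono : ∀ {A : Set} (x y : Maybe A) → (x ≡ nothing → y ≡ nothing) → isNothing x ≤ isNothing y
isNothing-mono nothing  nothing  _ = ≤-refl
isNothing-mono nothing  (just _) h with () ← h refl
isNothing-mono (just _) y        _ = z≤n

isNothing-< : ∀ {A : Set} (x y : Maybe A) → x ≢ nothing → y ≡ nothing → isNothing x < isNothing y
isNothing-< nothing  _ x≢ _    = ⊥-elim (x≢ refl)
isNothing-< (just _) _ _  refl = s≤s z≤n

#nothing : ∀ {A : Set} {n} → (Fin n → Maybe A) → ℕ
#nothing {n = zero}  c = 0
#nothing {n = suc n} c = isNothing (c zero) + #nothing (λ i → c (suc i))

#nothing-mono : ∀ {A : Set} {n} (c d : Fin n → Maybe A) →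
                (∀ x → d x ≡ nothing → c x ≡ nothing) → #nothing d ≤ #nothing c
#nothing-mono {n = zero}  c d _ = z≤n
#nothing-mono {n = suc n} c d d⊆c =
  +-mono-≤ (isNothing-mono (d zero) (c zero) (d⊆c zero))
           (#nothing-mono (λ i → c (suc i)) (λ i → d (suc i)) (λ x → d⊆c (suc x)))

#nothing-< : ∀ {A : Set} {n} (c d : Fin n → Maybe A) → (∀ x → d x ≡ nothing → c x ≡ nothing) →
             ∀ e → d e ≢ nothing → c e ≡ nothing → #nothing d < #nothing c
#nothing-< c d d⊆c zero d≢ c≡ =
  +-mono-<-≤ (isNothing-< (d zero) (c zero) d≢ c≡)
             (#nothing-mono (λ i → c (suc i)) (λ i → d (suc i)) (λ x → d⊆c (suc x)))
#nothing-< c d d⊆c (suc e) d≢ c≡ =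
  +-mono-≤-< (isNothing-mono (d zero) (c zero) (d⊆c zero))
             (#nothing-< (λ i → c (suc i)) (λ i → d (suc i)) (λ x → d⊆c (suc x)) e d≢ c≡)

SameEnds-euclidean : ∀ {V} {x y z : Fin V × Fin V} → SameEnds x z → SameEnds y z → SameEnds x y
SameEnds-euclidean (inj₁ (refl , refl)) (inj₁ (refl , refl)) = inj₁ (refl , refl)
SameEnds-euclidean (inj₁ (refl , refl)) (inj₂ (refl , refl)) = inj₂ (refl , refl)
SameEnds-euclidean (inj₂ (refl , refl)) (inj₁ (refl , refl)) = inj₂ (refl , refl)
SameEnds-euclidean (inj₂ (refl , refl)) (inj₂ (refl , refl)) = inj₁ (refl , refl)

Consecutive : ℕ → ℕ → Set
Consecutive i j = j ≡ suc i ⊎ i ≡ suc j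

consecutive-pigeonhole : ∀ {i a b c} → Consecutive i a → Consecutive i b → Consecutive i c →
                         a ≡ b ⊎ a ≡ c ⊎ b ≡ c
consecutive-pigeonhole (inj₁ refl) (inj₁ refl) _           = inj₁ refl
consecutive-pigeonhole (inj₁ refl) (inj₂ _)    (inj₁ refl) = inj₂ (inj₁ refl)
consecutive-pigeonhole (inj₁ _)    (inj₂ p)    (inj₂ q)    = inj₂ (inj₂ (suc-injective (trans (sym p) q)))
consecutive-pigeonhole (inj₂ p)    (inj₂ q)    _           = inj₁ (suc-injective (trans (sym p) q))
consecutive-pigeonhole (inj₂ p)    (inj₁ _)    (inj₂ q)    = inj₂ (inj₁ (suc-injective (trans (sym p) q)))
consecutive-pigeonhole (inj₂ _)    (inj₁ refl) (inj₁ refl) = inj₂ (inj₂ refl)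

module _ (G : Graph) where
  open Graph G

  incidentEdges : Fin V → List (Fin E)
  incidentEdges v = filter (incident? G v) (allFin E)

  edgeAt : ∀ v → Fin (deg G v) → Fin E
  edgeAt v = lookup (incidentEdges v)

  edgeAt-injective : ∀ v → Injective _≡_ _≡_ (edgeAt v)
  edgeAt-injective v = lookup-injective (incidentEdges v) (filter⁺ (incident? G v) (allFin⁺ E)) _ _

  edgeAt-incident : ∀ v i → Incident G v (edgeAt v i)
  edgeAt-incident v i = proj₂ (∈-filter⁻ (incident? G v) {xs = allFin E} (∈-lookup i))

  position : ∀ {v e} → Incident G v e → Fin (deg G v)
  position {v} {e} ve = index (∈-filter⁺ (incident? G v) (∈-allFin e) ve)

  position-injective : ∀ {v e f} (ve : Incident G v e) (vf : Incident G v f) →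
                       position ve ≡ position vf → e ≡ f
  position-injective {v} {e} {f} ve vf =
    SetoidMembership.index-injective (setoid (Fin E))
      (∈-filter⁺ (incident? G v) (∈-allFin e) ve) (∈-filter⁺ (incident? G v) (∈-allFin f) vf)

  ≤-deg : ∀ {n v} (h : Fin n → Fin E) → Injective _≡_ _≡_ h → (∀ i → Incident G v (h i)) →
          n ≤ deg G v
  ≤-deg h h-inj vh = injective⇒≤ λ {i} {j} eq → h-inj (position-injective (vh i) (vh j) eq)

  deg-≤ : ∀ {n v} (h : Fin E → Fin n) →
          (∀ {e f} → Incident G v e → Incident G v f → h e ≡ h f → e ≡ f) → deg G v ≤ n
  deg-≤ {v = v} h h-inj =
    injective⇒≤ λ {i} {j} eq →
      edgeAt-injective v (h-inj (edgeAt-incident v i) (edgeAt-incident v j) eq)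

  two-incident⇒2≤deg : ∀ {v e f} → Incident G v e → Incident G v f → e ≢ f → 2 ≤ deg G v
  two-incident⇒2≤deg {e = e} {f} ve vf e≢f = ≤-deg pair pair-injective incident
    where
    pair : Fin 2 → Fin E
    pair 0F = e
    pair 1F = f
    pair-injective : Injective _≡_ _≡_ pair
    pair-injective {0F} {0F} _  = refl
    pair-injective {0F} {1F} eq = ⊥-elim (e≢f eq)
    pair-injective {1F} {0F} eq = ⊥-elim (e≢f (sym eq))
    pair-injective {1F} {1F} _  = refl
    incident : ∀ i → Incident G _ (pair i)
    incident 0F = ve
    incident 1F = vf

  deg≤Δ : ∀ v → deg G v ≤ Δ G
  deg≤Δ v = foldr-preservesᵒ {P = deg G v ≤_} (λ x y → [ m≤n⇒m≤n⊔o y , m≤n⇒m≤o⊔n x ]) 0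
              (map (deg G) (allFin V))
              (inj₂ (Any.map⁺ (Any.map (λ { refl → ≤-refl }) (∈-allFin v))))

  Δ-lub : ∀ {n} → (∀ v → deg G v ≤ n) → Δ G ≤ n
  Δ-lub {n} deg≤n = foldr-preservesᵇ {P = _≤ n} ⊔-lub z≤n (All.map⁺ (All.tabulate⁺ deg≤n))

  adjEdges? : ∀ e g → Dec (AdjEdges G e g)
  adjEdges? e g = ¬? (e ≟ g) ×-dec any? (λ v → incident? G v e ×-dec incident? G v g)

  adjEdges-sym : ∀ {e g} → AdjEdges G e g → AdjEdges G g e
  adjEdges-sym (e≢g , v , ve , vg) = (λ g≡e → e≢g (sym g≡e)) , v , vg , ve

  same-ends⇒≡ : ∀ {e f x} → SameEnds (ends e) x → SameEnds (ends f) x → e ≡ f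
  same-ends⇒≡ {e} {f} ex fx = simple e f (SameEnds-euclidean ex fx)

  otherEnd : ∀ {v e} → Incident G v e → ∃[ w ] SameEnds (ends e) (v , w) × Incident G w e
  otherEnd {e = e} (inj₁ refl) = proj₂ (ends e) , inj₁ (refl , refl) , inj₂ refl
  otherEnd {e = e} (inj₂ refl) = proj₁ (ends e) , inj₂ (refl , refl) , inj₁ refl

  -- By the `members` field of a spine, these are exactly the edges with both ends on the spine;
  -- all other edges are pendant.
  SpineEdge : Fin E → Set
  SpineEdge e = 2 ≤ deg G (proj₁ (ends e)) × 2 ≤ deg G (proj₂ (ends e))

  spineEdge? : ∀ e → Dec (SpineEdge e)
  spineEdge? e = (2 ≤? deg G (proj₁ (ends e))) ×-dec (2 ≤? deg G (proj₂ (ends e)))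

  spineEdge-endpoint : ∀ {v e} → SpineEdge e → Incident G v e → 2 ≤ deg G v
  spineEdge-endpoint (d₁ , _) (inj₁ refl) = d₁
  spineEdge-endpoint (_ , d₂) (inj₂ refl) = d₂

  pendant-inner-end-unique : ∀ {v w f} → ¬ SpineEdge f → Incident G v f → Incident G w f →
                             2 ≤ deg G v → 2 ≤ deg G w → v ≡ w
  pendant-inner-end-unique _ (inj₁ refl) (inj₁ refl) _  _  = refl
  pendant-inner-end-unique ¬s (inj₁ refl) (inj₂ refl) dv dw = ⊥-elim (¬s (dv , dw))
  pendant-inner-end-unique ¬s (inj₂ refl) (inj₁ refl) dv dw = ⊥-elim (¬s (dw , dv))
  pendant-inner-end-unique _ (inj₂ refl) (inj₂ refl) _  _  = refl

  -- The leaf end of a pendant edge meets no other edge, so all its neighbours share its other end.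
  pendant-hub : ∀ {e} → ¬ SpineEdge e →
                ∃[ u ] Incident G u e × (∀ {g} → AdjEdges G e g → Incident G u g)
  pendant-hub {e} ¬s with 2 ≤? deg G (proj₁ (ends e)) | 2 ≤? deg G (proj₂ (ends e))
  ... | yes d₁ | yes d₂ = ⊥-elim (¬s (d₁ , d₂))
  ... | no ¬d₁ | _      = proj₂ (ends e) , inj₂ refl , λ where
    (e≢g , _ , inj₁ refl , vg) → ⊥-elim (¬d₁ (two-incident⇒2≤deg (inj₁ refl) vg e≢g))
    (_   , _ , inj₂ refl , vg) → vg
  ... | yes _  | no ¬d₂ = proj₁ (ends e) , inj₁ refl , λ where
    (_   , _ , inj₁ refl , vg) → vg
    (e≢g , _ , inj₂ refl , vg) → ⊥-elim (¬d₂ (two-incident⇒2≤deg (inj₂ refl) vg e≢g))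

  adjacent-at-second-end : ∀ {e g} → AdjEdges G e g → ¬ Incident G (proj₁ (ends e)) g →
                           Incident G (proj₂ (ends e)) g
  adjacent-at-second-end (_ , _ , inj₁ refl , vg) ¬vg = ⊥-elim (¬vg vg)
  adjacent-at-second-end (_ , _ , inj₂ refl , vg) _   = vg

  neighbourClass : Fin E → Fin E → Fin E → Fin 3
  neighbourClass e f g with g ≟ f | incident? G (proj₁ (ends e)) g
  ... | yes _ | _     = 0F
  ... | no _  | yes _ = 1F
  ... | no _  | no _  = 2F

  module _ {ℓ} {s : Fin ℓ → Fin V} (spine : IsSpine G ℓ s) where
    open IsSpine spine

    spineEdge-step : ∀ {e i} → SpineEdge e → Incident G (s i) e →
                     ∃[ j ] SameEnds (ends e) (s i , s j) × Consecutive (toℕ i) (toℕ j)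
    spineEdge-step {e} {i} se ie with otherEnd ie
    ... | w , ends≡ , we with Equivalence.from (members w) (spineEdge-endpoint se we)
    ...   | j , refl = j , ends≡ , induced i j (e , ends≡)

    -- The spine is an induced path, so a spine vertex has at most two spine neighbours.
    spineEdge-other-unique : ∀ {v e g g′} → SpineEdge e → Incident G v e →
                             SpineEdge g → Incident G v g → SpineEdge g′ → Incident G v g′ →
                             g ≢ e → g′ ≢ e → g ≡ g′
    spineEdge-other-unique se ve sg vg sg′ vg′ g≢e g′≢e
      with Equivalence.from (members _) (spineEdge-endpoint se ve)
    ... | i , refl with spineEdge-step se ve | spineEdge-step sg vg | spineEdge-step sg′ vg′
    ...   | j , ej , cj | j₁ , gj₁ , cj₁ | j₂ , g′j₂ , cj₂ with consecutive-pigeonhole cj cj₁ cj₂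
    ...     | inj₁ j≡j₁         rewrite toℕ-injective j≡j₁  = ⊥-elim (g≢e (same-ends⇒≡ gj₁ ej))
    ...     | inj₂ (inj₁ j≡j₂)  rewrite toℕ-injective j≡j₂  = ⊥-elim (g′≢e (same-ends⇒≡ g′j₂ ej))
    ...     | inj₂ (inj₂ j₁≡j₂) rewrite toℕ-injective j₁≡j₂ = same-ends⇒≡ gj₁ g′j₂

    no-three-spineEdges-at-pendant : ∀ {f x y z} → ¬ SpineEdge f →
                                     SpineEdge x → SpineEdge y → SpineEdge z →
                                     AdjEdges G x f → AdjEdges G y f → AdjEdges G z f →
                                     y ≢ x → z ≢ x → y ≢ z → ⊥
    no-three-spineEdges-at-pendant ¬sf sx sy sz
      (_ , _ , vx , fx) (_ , _ , vy , fy) (_ , _ , vz , fz) y≢x z≢x y≢z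
      with pendant-inner-end-unique ¬sf fy fx (spineEdge-endpoint sy vy) (spineEdge-endpoint sx vx)
         | pendant-inner-end-unique ¬sf fz fx (spineEdge-endpoint sz vz) (spineEdge-endpoint sx vx)
    ... | refl | refl = y≢z (spineEdge-other-unique sx vx sy vy sz vz y≢x z≢x)

    neighbourClass-injective : ∀ {e f g g′} → SpineEdge e → AdjEdges G e g → AdjEdges G e g′ →
                               (g ≢ f → SpineEdge g) → (g′ ≢ f → SpineEdge g′) →
                               neighbourClass e f g ≡ neighbourClass e f g′ → g ≡ g′
    neighbourClass-injective {e} {f} {g} {g′} se eg eg′ sg sg′
      with g ≟ f | incident? G (proj₁ (ends e)) g | g′ ≟ f | incident? G (proj₁ (ends e)) g′
    ... | yes refl | _      | yes refl | _       = λ _ → refl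
    ... | no g≢f   | yes vg | no g′≢f  | yes vg′ = λ _ →
      spineEdge-other-unique se (inj₁ refl) (sg g≢f) vg (sg′ g′≢f) vg′
        (≢-sym (proj₁ eg)) (≢-sym (proj₁ eg′))
    ... | no g≢f   | no ¬vg | no g′≢f  | no ¬vg′ = λ _ →
      spineEdge-other-unique se (inj₂ refl) (sg g≢f) (adjacent-at-second-end eg ¬vg)
        (sg′ g′≢f) (adjacent-at-second-end eg′ ¬vg′) (≢-sym (proj₁ eg)) (≢-sym (proj₁ eg′))
    ... | yes _ | _     | no _  | yes _ = λ ()
    ... | yes _ | _     | no _  | no _  = λ ()
    ... | no _  | yes _ | yes _ | _     = λ ()
    ... | no _  | no _  | yes _ | _     = λ ()
    ... | no _  | yes _ | no _  | no _  = λ ()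
    ... | no _  | no _  | no _  | yes _ = λ ()

module ColouringGame (G : Graph) (m k : ℕ) where
  open Graph G
  open Game G m k

  update-≡ : ∀ c e a → update c e a e ≡ just a
  update-≡ c e a with e ≟ e
  ... | yes _   = refl
  ... | no e≢e = ⊥-elim (e≢e refl)

  update-≢ : ∀ c e a {x} → x ≢ e → update c e a x ≡ c x
  update-≢ c e a {x} x≢e with x ≟ e
  ... | yes x≡e = ⊥-elim (x≢e x≡e)
  ... | no _    = refl

  update-nothing : ∀ c e a {x} → update c e a x ≡ nothing → x ≢ e × c x ≡ nothing
  update-nothing c e a {x} eq with x ≟ e
  ... | no x≢e = x≢e , eq

  update-just : ∀ c e a {x b} → update c e a x ≡ just b → (x ≡ e × a ≡ b) ⊎ c x ≡ just b
  update-just c e a {x} eq with x ≟ e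
  ... | yes x≡e = inj₁ (x≡e , just-injective eq)
  ... | no _    = inj₂ eq

  holes : Coloring → ℕ
  holes = #nothing

  holes-update-< : ∀ {c e a} → Legal c e a → holes (update c e a) < holes c
  holes-update-< {c} {e} {a} (ce , _) =
    #nothing-< c (update c e a) (λ x eq → proj₂ (update-nothing c e a eq)) e
      (≡just⇒≢nothing (update-≡ c e a)) ce

  hole-or-complete : ∀ c → (∃[ e ] c e ≡ nothing) ⊎ Complete c
  hole-or-complete c with any? (λ e → ≡-dec _≟_ (c e) nothing)
  ... | yes hole = inj₁ hole
  ... | no ¬hole = inj₂ (λ e ce → ¬hole (e , ce))

  record Blocked (c : Coloring) (e : Fin E) (a : Fin k) : Set where
    constructor blocked
    field
      blocker  : Fin E
      adjacent : AdjEdges G e blocker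
      coloured : c blocker ≡ just a
  open Blocked

  blocked? : ∀ c e a → Dec (Blocked c e a)
  blocked? c e a = map′ (λ (g , eg , cg) → blocked g eg cg) (λ (blocked g eg cg) → g , eg , cg)
                        (any? λ g → adjEdges? G e g ×-dec ≡-dec _≟_ (c g) (just a))

  legal-or-blocked : ∀ c e → c e ≡ nothing → (∃[ a ] Legal c e a) ⊎ (∀ a → Blocked c e a)
  legal-or-blocked c e ce with all? (blocked? c e)
  ... | yes all-blocked = inj₂ all-blocked
  ... | no ¬blocked with ¬∀⟶∃¬ k (Blocked c e) (blocked? c e) ¬blocked
  ...   | a , ¬a = inj₁ (a , ce , λ g eg cg → ¬a (blocked g eg cg))

  blocker-injective : ∀ {c e} (b : ∀ a → Blocked c e a) → Injective _≡_ _≡_ (λ a → blocker (b a))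
  blocker-injective {c} b {x} {y} eq = just-injective (begin
    just x              ≡⟨ coloured (b x) ⟨
    c (blocker (b x))   ≡⟨ cong c eq ⟩
    c (blocker (b y))   ≡⟨ coloured (b y) ⟩
    just y              ∎)
    where open ≡-Reasoning

  -- A pendant edge together with its k blockers are k + 1 distinct edges at one vertex.
  pendant-legal : Δ G ≤ k → ∀ c e → c e ≡ nothing → ¬ SpineEdge G e → ∃[ a ] Legal c e a
  pendant-legal Δ≤k c e ce ¬se with legal-or-blocked c e ce
  ... | inj₁ legal = legal
  ... | inj₂ b with pendant-hub G ¬se
  ...   | u , ue , hub =
    ⊥-elim (<-irrefl refl (≤-trans (≤-deg G edges edges-injective incident)
                                   (≤-trans (deg≤Δ G u) Δ≤k)))
    where
    edges : Fin (suc k) → Fin E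
    edges zero    = e
    edges (suc a) = blocker (b a)
    edges-injective : Injective _≡_ _≡_ edges
    edges-injective {zero}  {zero}  _  = refl
    edges-injective {zero}  {suc y} eq = ⊥-elim (proj₁ (adjacent (b y)) eq)
    edges-injective {suc x} {zero}  eq = ⊥-elim (proj₁ (adjacent (b x)) (sym eq))
    edges-injective {suc x} {suc y} eq = cong suc (blocker-injective b eq)
    incident : ∀ i → Incident G u (edges i)
    incident zero    = ue
    incident (suc a) = hub (adjacent (b a))

  Proper : Coloring → Set
  Proper c = ∀ {e g a} → AdjEdges G e g → c e ≡ just a → c g ≢ just a

  proper-update : ∀ {c e a} → Proper c → Legal c e a → Proper (update c e a)
  proper-update {c} {e} {a} proper (_ , fresh) {x} {y} xy ux uy
    with update-just c e a ux | update-just c e a uy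
  ... | inj₁ (refl , _)    | inj₁ (refl , _)    = proj₁ xy refl
  ... | inj₁ (refl , refl) | inj₂ cy            = fresh y xy cy
  ... | inj₂ cx            | inj₁ (refl , refl) = fresh x (adjEdges-sym G xy) cx
  ... | inj₂ cx            | inj₂ cy            = proper xy cx cy

  completion : ∀ {t c} → MakerWins t c → Proper c → ∃[ c′ ] Complete c′ × Proper c′
  completion (complete {c = c} done) proper = c , done , proper
  completion (maker e a legal w) proper = completion w (proper-update proper legal)
  completion (breaker (e , a , legal) w) proper = completion (w e a legal) (proper-update proper legal)

  complete-proper⇒Δ≤k : ∀ {c} → Complete c → Proper c → Δ G ≤ k
  complete-proper⇒Δ≤k {c} done proper = Δ-lub G λ v → deg-≤ G colour (distinct v)
    where
    colour : Fin E → Fin k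
    colour e = proj₁ (extract (c e) (done e))
    distinct : ∀ v {e f} → Incident G v e → Incident G v f → colour e ≡ colour f → e ≡ f
    distinct v {e} {f} ve vf eq with e ≟ f
    ... | yes e≡f = e≡f
    ... | no e≢f  = ⊥-elim (proper (e≢f , v , ve , vf) (proj₂ (extract (c e) (done e)))
                                   (trans (proj₂ (extract (c f) (done f))) (cong just (sym eq))))

  no-win-below-Δ : k < Δ G → ¬ MakerHasWinningStrategy
  no-win-below-Δ k<Δ win with completion win (λ _ ())
  ... | c , done , proper = <-irrefl refl (<-≤-trans k<Δ (complete-proper⇒Δ≤k done proper))

module MakerStrategy (G : Graph) {ℓ} {s : Fin ℓ → Fin (Graph.V G)} (spine : IsSpine G ℓ s)
                     (m′ k : ℕ) (Δ≤k : Δ G ≤ k) (4≤k : 4 ≤ k) where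
  open Graph G
  open Game G (2 + m′) k
  open ColouringGame G (2 + m′) k
  open Blocked

  -- Besides f, a spine edge meets at most one spine edge at each end, so at most 3 < k colours
  -- are blocked.
  spineEdge-legal : ∀ {c e f} → c e ≡ nothing → SpineEdge G e →
                    (∀ {g} → AdjEdges G e g → c g ≢ nothing → g ≢ f → SpineEdge G g) →
                    ∃[ a ] Legal c e a
  spineEdge-legal {c} {e} {f} ce se spine-unless-f with legal-or-blocked c e ce
  ... | inj₁ legal = legal
  ... | inj₂ b     = ⊥-elim (<-irrefl refl (≤-trans 4≤k (injective⇒≤ classes-injective)))
    where
    spine-blocker : ∀ a → blocker (b a) ≢ f → SpineEdge G (blocker (b a))
    spine-blocker a = spine-unless-f (adjacent (b a)) (≡just⇒≢nothing (coloured (b a)))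
    classes-injective : Injective _≡_ _≡_ (λ a → neighbourClass G e f (blocker (b a)))
    classes-injective {a} {a′} eq = blocker-injective b
      (neighbourClass-injective G spine se (adjacent (b a)) (adjacent (b a′))
        (spine-blocker a) (spine-blocker a′) eq)

  record Threat (c : Coloring) (e g : Fin E) : Set where
    constructor threat
    field
      e-uncoloured : c e ≡ nothing
      e-spine      : SpineEdge G e
      g-coloured   : c g ≢ nothing
      g-pendant    : ¬ SpineEdge G g
      touches      : AdjEdges G e g
  open Threat

  threat? : ∀ c e g → Dec (Threat c e g)
  threat? c e g =
    map′ (λ (ce , se , cg , ¬sg , eg) → threat ce se cg ¬sg eg)
         (λ (threat ce se cg ¬sg eg) → ce , se , cg , ¬sg , eg)
         (≡-dec _≟_ (c e) nothing ×-dec spineEdge? G e ×-dec ¬? (≡-dec _≟_ (c g) nothing)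
           ×-dec ¬? (spineEdge? G g) ×-dec adjEdges? G e g)

  Calm : Coloring → Set
  Calm c = ∀ {e g} → ¬ Threat c e g

  ThreatsOnlyFrom : Fin E → Coloring → Set
  ThreatsOnlyFrom f c = ∀ {e g} → Threat c e g → g ≡ f

  threat-or-calm : ∀ c → (∃[ e ] ∃[ g ] Threat c e g) ⊎ Calm c
  threat-or-calm c with any? (λ e → any? (threat? c e))
  ... | yes (e , g , t) = inj₁ (e , g , t)
  ... | no ¬t           = inj₂ (λ {e} {g} t → ¬t (e , g , t))

  threat-update : ∀ {c e a x g} → Threat (update c e a) x g → Threat c x g ⊎ g ≡ e
  threat-update {c} {e} {a} {x} {g} t with g ≟ e
  ... | yes g≡e = inj₂ g≡e
  ... | no g≢e  = inj₁ (threat (proj₂ (update-nothing c e a (e-uncoloured t))) (e-spine t)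
                               (λ cg → g-coloured t (trans (update-≢ c e a g≢e) cg))
                               (g-pendant t) (touches t))

  calm-update : ∀ {c e a} → Calm c → ThreatsOnlyFrom e (update c e a)
  calm-update calm t with threat-update t
  ... | inj₁ t′  = ⊥-elim (calm t′)
  ... | inj₂ g≡e = g≡e

  legal-move : ∀ {f c e} → ThreatsOnlyFrom f c → c e ≡ nothing → ∃[ a ] Legal c e a
  legal-move {f} {c} {e} only ce with spineEdge? G e
  ... | no ¬se = pendant-legal Δ≤k c e ce ¬se
  ... | yes se = spineEdge-legal ce se spine-unless-f
    where
    spine-unless-f : ∀ {g} → AdjEdges G e g → c g ≢ nothing → g ≢ f → SpineEdge G g
    spine-unless-f {g} eg cg g≢f with spineEdge? G g
    ... | yes sg  = sg
    ... | no ¬sg = ⊥-elim (g≢f (only (threat ce se cg ¬sg eg)))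

  calm-legal : ∀ {c : Coloring} {e} → Calm c → c e ≡ nothing → ∃[ a ] Legal c e a
  calm-legal {e = e} calm = legal-move {f = e} (λ t → ⊥-elim (calm t))

  uncoloured-spineEdge? : ∀ (c : Coloring) → Dec (∃[ e ] c e ≡ nothing × SpineEdge G e)
  uncoloured-spineEdge? c = any? {P = λ e → c e ≡ nothing × SpineEdge G e}
                              λ e → ≡-dec _≟_ (c e) nothing ×-dec spineEdge? G e

  calm-wins : ∀ {c} → Acc _<_ (holes c) → Calm c → ∀ t → MakerWins t c
  answer-wins : ∀ {c f} → Acc _<_ (holes c) → ThreatsOnlyFrom f c → MakerWins (makerTurn (2 + m′)) c
  second-answer-wins : ∀ {c e₁ f} → Acc _<_ (holes c) → SpineEdge G e₁ → AdjEdges G e₁ f →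
                       c e₁ ≢ nothing → ThreatsOnlyFrom f c → MakerWins (makerTurn (1 + m′)) c

  calm-wins {c} (acc rs) calm breakerTurn with hole-or-complete c
  ... | inj₂ done    = complete done
  ... | inj₁ (e , ce) = breaker (e , calm-legal calm ce)
                          λ e a legal → answer-wins (rs (holes-update-< legal)) (calm-update calm)
  calm-wins {c} (acc rs) calm (makerTurn r) with uncoloured-spineEdge? c
  ... | yes (e , ce , se) with calm-legal calm ce
  ...   | a , legal = maker e a legal (calm-wins (rs (holes-update-< legal)) calm′ _)
    where
    calm′ : Calm (update c e a)
    calm′ t with threat-update t
    ... | inj₁ t′   = calm t′
    ... | inj₂ refl = g-pendant t se
  calm-wins {c} (acc rs) calm (makerTurn r) | no none with hole-or-complete c
  ... | inj₂ done     = complete done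
  ... | inj₁ (e , ce) with calm-legal calm ce
  ...   | a , legal = maker e a legal (calm-wins (rs (holes-update-< legal)) calm′ _)
    where
    calm′ : Calm (update c e a)
    calm′ {x} t = none (x , proj₂ (update-nothing c e a (e-uncoloured t)) , e-spine t)

  answer-wins {c} {f} ac only with threat-or-calm c
  ... | inj₂ calm = calm-wins ac calm _
  ... | inj₁ (e₁ , g₁ , t₁) with legal-move only (e-uncoloured t₁) | ac
  ...   | a₁ , legal₁ | acc rs = maker e₁ a₁ legal₁
          (second-answer-wins (rs (holes-update-< legal₁)) (e-spine t₁) e₁f
            (≡just⇒≢nothing (update-≡ c e₁ a₁)) only₁)
    where
    e₁f : AdjEdges G e₁ f
    e₁f = subst (AdjEdges G e₁) (only t₁) (touches t₁)
    only₁ : ThreatsOnlyFrom f (update c e₁ a₁)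
    only₁ t with threat-update t
    ... | inj₁ t′   = only t′
    ... | inj₂ refl = ⊥-elim (g-pendant t (e-spine t₁))

  second-answer-wins {c} {e₁} {f} ac se₁ e₁f ce₁ only with threat-or-calm c
  ... | inj₂ calm = calm-wins ac calm _
  ... | inj₁ (e₂ , g₂ , t₂) with legal-move only (e-uncoloured t₂) | ac
  ...   | a₂ , legal₂ | acc rs =
          maker e₂ a₂ legal₂ (calm-wins (rs (holes-update-< legal₂)) calm₂ _)
    where
    ≢e₁ : ∀ {x} → c x ≡ nothing → x ≢ e₁
    ≢e₁ cx refl = ce₁ cx
    calm₂ : Calm (update c e₂ a₂)
    calm₂ t with threat-update t
    ... | inj₂ refl = g-pendant t (e-spine t₂)
    ... | inj₁ t′ with only t′
    ...   | refl = no-three-spineEdges-at-pendant G spine (g-pendant t′) se₁ (e-spine t₂) (e-spine t′)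
                     e₁f (subst (AdjEdges G e₂) (only t₂) (touches t₂)) (touches t′)
                     (≢e₁ (e-uncoloured t₂)) (≢e₁ (e-uncoloured t′))
                     (≢-sym (proj₁ (update-nothing c e₂ a₂ (e-uncoloured t))))

  maker-wins : MakerHasWinningStrategy
  maker-wins = calm-wins (<-wellFounded _) (λ t → g-coloured t refl) _

theorem3p1 : (T : Graph) → IsCaterpillar T → (m : ℕ) → 2 ≤ m →
    4 ≤ Δ T → GameChromaticIndexIs T m (Δ T)
theorem3p1 T (_ , _ , _ , spine) (suc (suc m′)) (s≤s (s≤s _)) 4≤Δ =
  MakerStrategy.maker-wins T spine m′ (Δ T) ≤-refl 4≤Δ ,
  λ j j<Δ → ColouringGame.no-win-below-Δ T (suc (suc m′)) j j<Δ
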